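{- Let $W$ be a positive integer, let $\mathcal F=T_1,\dots,T_k$ be a rooted ordered forest with $m\le W$ vertices, and let $\Gamma$ be a $◸$-drawing of $\mathcal F$. Then for each vertex $v$ of $\mathcal F$, the wedge $S(v)$ contains the segment from $(2W+2,0)$ to $(4W,0)$ in its interior.
   Context: A rooted ordered forest is a sequence of rooted trees with a left-to-right order of the children of every vertex. A drawing is strictly-upward (resp. strictly-leftward) if each edge is a curve strictly increasing in $y$ (resp. strictly decreasing in $x$) from a vertex to its parent; order-preserving if the left-to-right order of edges to children matches the given order. For a point $v$, $\ell(v)$ is the closed half-line from $v$ with slope $-2$ going downward to the right, and $S(v)$ is the closed wedge with apex $v$ swept by rotating the rightward horizontal half-line from $v$ clockwise until it coincides with $\ell(v)$. A $◸$-drawing of $\mathcal F$ (w.r.t. $W$) is a planar straight-line strictly-upward strictly-leftward order-preserving drawing with vertices at integer points such that: (i) it lies in $[0,m-1]\times[4W-2m+2,4W]$; (ii) the roots $r(T_1),\dots,r(T_k)$ lie on the segment from $(0,2W+2)$ to $(0,4W)$ in this order bottom to top, with $r(T_k)$ at $(0,4W)$; (iii) vertices of $T_i$ have $y$-coordinates strictly smaller than those of $T_{i+1}$; (iv) for each vertex $v$ with children $u_1,\dots,u_\ell$ in left-to-right order, vertices of the subtree rooted at $u_j$ have $y$-coordinates strictly smaller than those of the subtree rooted at $u_{j+1}$; (v) for every vertex $v$, $S(v)$ meets the drawing only along $\ell(v)$.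
   Formalization: The wedge $S(v)$ is shown to contain in its interior only the rational points of the segment from $(2W+2,0)$ to $(4W,0)$, rather than all its real points. -}

module Defs where

open import Data.Nat as ℕ using (ℕ)
open import Data.Integer as ℤ using (ℤ; +_; 0ℤ)
open import Data.Rational as ℚ using (ℚ; 0ℚ; 1ℚ)
open import Data.Product using (_×_; _,_; proj₁; proj₂; ∃-syntax)
open import Data.Sum using (_⊎_)
open import Data.List using (List; []; _∷_; _++_; map; length; last)
open import Data.Maybe using (just)
import Data.Maybe as Maybe
open import Data.List.Membership.Propositional using (_∈_)
open import Data.List.Relation.Unary.All using (All)
open import Data.List.Relation.Unary.AllPairs using (AllPairs)
open import Data.List.Relation.Unary.Linked using (Linked)
open import Data.List.Relation.Unary.Unique.Propositional using (Unique)
open import Relation.Binary.PropositionalEquality using (_≡_)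
open import Relation.Nullary using (¬_)

Point : Set
Point = ℤ × ℤ

QPoint : Set
QPoint = ℚ × ℚ

xc : Point → ℤ
xc = proj₁

yc : Point → ℤ
yc = proj₂

toQ : Point → QPoint
toQ (x , y) = (x ℚ./ 1) , (y ℚ./ 1)

OnSeg : QPoint → QPoint → QPoint → Set
OnSeg (ax , ay) (bx , by) (rx , ry) =
  ∃[ t ] (0ℚ ℚ.≤ t × t ℚ.≤ 1ℚ ×
          rx ≡ ax ℚ.+ t ℚ.* (bx ℚ.- ax) ×
          ry ≡ ay ℚ.+ t ℚ.* (by ℚ.- ay))

two : ℚ
two = + 2 ℚ./ 1

InL : Point → QPoint → Set
InL v (rx , ry) =
  let dx = rx ℚ.- proj₁ (toQ v) ; dy = ry ℚ.- proj₂ (toQ v)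
  in (0ℚ ℚ.≤ dx) × (dy ≡ ℚ.- (two ℚ.* dx))

-- S(v): closed wedge between the rightward horizontal ray and ℓ(v)
InS : Point → QPoint → Set
InS v (rx , ry) =
  let dx = rx ℚ.- proj₁ (toQ v) ; dy = ry ℚ.- proj₂ (toQ v)
  in (dy ℚ.≤ 0ℚ) × (0ℚ ℚ.≤ two ℚ.* dx ℚ.+ dy)

InIntS : Point → QPoint → Set
InIntS v (rx , ry) =
  let dx = rx ℚ.- proj₁ (toQ v) ; dy = ry ℚ.- proj₂ (toQ v)
  in (dy ℚ.< 0ℚ) × (0ℚ ℚ.< two ℚ.* dx ℚ.+ dy)

-- Drawn rooted ordered forests: a rooted ordered tree whose every vertex
-- carries its (integer) position in the drawing; children are listed in
-- their given left-to-right order.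

data DTree : Set where
  node : Point → List DTree → DTree

DForest : Set
DForest = List DTree

root : DTree → Point
root (node p _) = p

children : DTree → List DTree
children (node _ ts) = ts

mutual
  verts : DTree → List Point
  verts (node p ts) = p ∷ vertsF ts

  vertsF : DForest → List Point
  vertsF [] = []
  vertsF (t ∷ ts) = verts t ++ vertsF ts

mutual
  edges : DTree → List (Point × Point)
  edges (node p ts) = map (λ t → root t , p) ts ++ edgesF ts

  edgesF : DForest → List (Point × Point)
  edgesF [] = []
  edgesF (t ∷ ts) = edges t ++ edgesF ts

mutual
  subs : DTree → List DTree
  subs (node p ts) = node p ts ∷ subsF ts

  subsF : DForest → List DTree
  subsF [] = []
  subsF (t ∷ ts) = subs t ++ subsF ts

nVerts : DForest → ℕ
nVerts F = length (vertsF F)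

OnDrawing : DForest → QPoint → Set
OnDrawing F r =
  (∃[ w ] (w ∈ vertsF F × r ≡ toQ w)) ⊎
  (∃[ e ] (e ∈ edgesF F × OnSeg (toQ (proj₁ e)) (toQ (proj₂ e)) r))

Planar : DForest → Set
Planar F =
  Unique (vertsF F) ×
  (∀ w e → w ∈ vertsF F → e ∈ edgesF F →
     OnSeg (toQ (proj₁ e)) (toQ (proj₂ e)) (toQ w) →
     (w ≡ proj₁ e) ⊎ (w ≡ proj₂ e)) ×
  (∀ e f r → e ∈ edgesF F → f ∈ edgesF F → ¬ (e ≡ f) →
     OnSeg (toQ (proj₁ e)) (toQ (proj₂ e)) r →
     OnSeg (toQ (proj₁ f)) (toQ (proj₂ f)) r →
     ((r ≡ toQ (proj₁ e)) ⊎ (r ≡ toQ (proj₂ e))) ×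
     ((r ≡ toQ (proj₁ f)) ⊎ (r ≡ toQ (proj₂ f))))

StrictlyUpward : DForest → Set
StrictlyUpward F = All (λ e → yc (proj₁ e) ℤ.< yc (proj₂ e)) (edgesF F)

StrictlyLeftward : DForest → Set
StrictlyLeftward F = All (λ e → xc (proj₂ e) ℤ.< xc (proj₁ e)) (edgesF F)

cross : Point → Point → Point → ℤ
cross v a b =
  (xc a ℤ.- xc v) ℤ.* (yc b ℤ.- yc v) ℤ.- (yc a ℤ.- yc v) ℤ.* (xc b ℤ.- xc v)

-- the edges to the children of v appear in the given left-to-right order,
-- i.e. counterclockwise around v (children lie below v)
OrderPreserving : DForest → Set
OrderPreserving F =
  All (λ s → AllPairs (λ a b → 0ℤ ℤ.< cross (root s) (root a) (root b))
                      (children s))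
      (subsF F)

Below : DTree → DTree → Set
Below T T' = ∀ p q → p ∈ verts T → q ∈ verts T' → yc p ℤ.< yc q

IsCornerDrawing : ℕ → DForest → Set
IsCornerDrawing W F =
  let m  = nVerts F
      W' = + W
      m' = + m
  in
  Planar F × StrictlyUpward F × StrictlyLeftward F × OrderPreserving F ×
  -- (i) bounding box [0,m-1] × [4W-2m+2, 4W]
  All (λ p → (0ℤ ℤ.≤ xc p) × (xc p ℤ.≤ m' ℤ.- + 1) ×
             (+ 4 ℤ.* W' ℤ.- + 2 ℤ.* m' ℤ.+ + 2 ℤ.≤ yc p) ×
             (yc p ℤ.≤ + 4 ℤ.* W'))
      (vertsF F) ×
  All (λ p → (xc p ≡ 0ℤ) × (+ 2 ℤ.* W' ℤ.+ + 2 ℤ.≤ yc p) ×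
             (yc p ℤ.≤ + 4 ℤ.* W'))
      (map root F) ×
  Linked (λ p q → yc p ℤ.< yc q) (map root F) ×
  Maybe.map root (last F) ≡ just (0ℤ , + 4 ℤ.* W') ×
  Linked Below F ×
  All (λ s → Linked Below (children s)) (subsF F) ×
  -- (v) S(v) meets the drawing only along ℓ(v)
  (∀ v r → v ∈ vertsF F → OnDrawing F r → InS v r → InL v r)

-- Let level (x , y) = 2x + y; its level sets are the lines parallel to ℓ(v).
-- For an edge from a child c up to its parent p, if level c ≥ level p then c
-- lies in S(p), so by (v) it lies on ℓ(p) and level c = level p; hence levels
-- never increase from a parent to a child. The roots lie on x = 0 below
-- (0, 4W), so every vertex v has level v ≤ 4W, and v lies strictly above the
-- x-axis by (i) and m ≤ W. A point (r, 0) with r ≥ 2W + 2 then satisfies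
-- 2 (r - x) - y ≥ 4W + 4 - level v > 0 and 0 - y < 0: it is interior to S(v).
module Submission where

open import Defs
open import Data.Nat using (ℕ; _≤_; _*_; _+_)
open import Data.Integer using (+_)
open import Data.Rational using (_/_; 0ℚ)
open import Data.Product using (_,_)
open import Data.List.Membership.Propositional using (_∈_)

import Data.Nat as ℕ
import Data.Nat.Properties as ℕP
open import Data.Integer as ℤ using (ℤ; 0ℤ; +0; +[1+_]; -[1+_])
import Data.Integer.Properties as ℤP
open import Data.Integer.Tactic.RingSolver using (solve-∀)
open import Data.Nat.Tactic.RingSolver using () renaming (solve-∀ to ℕ-solve-∀)
open import Data.Rational as ℚ using (ℚ; mkℚ)
import Data.Rational.Properties as ℚP
open import Data.Nat.Coprimality using (1-coprimeTo) renaming (sym to coprime-sym)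
open import Data.Product using (_×_; proj₁; proj₂)
open import Data.Sum using (inj₁; inj₂)
open import Data.List using (List; []; _∷_; map)
open import Data.List.Membership.Propositional.Properties
  using (∈-++⁺ˡ; ∈-++⁺ʳ; ∈-++⁻; ∈-map⁺; ∈-map⁻)
open import Data.List.Relation.Unary.Any using (here; there)
open import Data.List.Relation.Unary.All as All using (All; []; _∷_)
import Data.List.Relation.Unary.All.Properties as AllP
open import Relation.Binary.PropositionalEquality
open ≡-Reasoning

fromℤ : ℤ → ℚ
fromℤ i = i / 1

mkℚ₁ : ℤ → ℚ
mkℚ₁ i = mkℚ i 0 (coprime-sym (1-coprimeTo ℤ.∣ i ∣))

-- Rewriting with this equation lets the rational operations on fromℤ i
-- compute, reducing their homomorphism properties to integer ones.
fromℤ≡mkℚ₁ : ∀ i → fromℤ i ≡ mkℚ₁ i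
fromℤ≡mkℚ₁ i = ℚP.↥p/↧p≡p _

fromℤ-homo-+ : ∀ i j → fromℤ (i ℤ.+ j) ≡ fromℤ i ℚ.+ fromℤ j
fromℤ-homo-+ i j rewrite fromℤ≡mkℚ₁ i | fromℤ≡mkℚ₁ j =
  cong fromℤ (cong₂ ℤ._+_ (sym (ℤP.*-identityʳ i)) (sym (ℤP.*-identityʳ j)))

fromℤ-homo-* : ∀ i j → fromℤ (i ℤ.* j) ≡ fromℤ i ℚ.* fromℤ j
fromℤ-homo-* i j rewrite fromℤ≡mkℚ₁ i | fromℤ≡mkℚ₁ j = refl

fromℤ-homo-‿- : ∀ i → fromℤ (ℤ.- i) ≡ ℚ.- fromℤ i
fromℤ-homo-‿- i = begin
  fromℤ (ℤ.- i)  ≡⟨ fromℤ≡mkℚ₁ (ℤ.- i) ⟩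
  _              ≡⟨ mkℚ₁-neg i ⟩
  _              ≡⟨ cong ℚ.-_ (sym (fromℤ≡mkℚ₁ i)) ⟩
  ℚ.- fromℤ i    ∎
  where
  mkℚ₁-neg : ∀ i → mkℚ₁ (ℤ.- i) ≡ ℚ.- mkℚ₁ i
  mkℚ₁-neg +0       = refl
  mkℚ₁-neg +[1+ n ] = refl
  mkℚ₁-neg -[1+ n ] = refl

fromℤ-homo-- : ∀ i j → fromℤ (i ℤ.- j) ≡ fromℤ i ℚ.- fromℤ j
fromℤ-homo-- i j = trans (fromℤ-homo-+ i (ℤ.- j)) (cong (fromℤ i ℚ.+_) (fromℤ-homo-‿- j))

fromℤ-injective : ∀ {i j} → fromℤ i ≡ fromℤ j → i ≡ j
fromℤ-injective {i} {j} eq =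
  cong ℚ.↥_ (trans (sym (fromℤ≡mkℚ₁ i)) (trans eq (fromℤ≡mkℚ₁ j)))

fromℤ-mono-≤ : ∀ {i j} → i ℤ.≤ j → fromℤ i ℚ.≤ fromℤ j
fromℤ-mono-≤ {i} {j} i≤j rewrite fromℤ≡mkℚ₁ i | fromℤ≡mkℚ₁ j =
  ℚ.*≤* (subst₂ ℤ._≤_ (sym (ℤP.*-identityʳ i)) (sym (ℤP.*-identityʳ j)) i≤j)

fromℤ-mono-< : ∀ {i j} → i ℤ.< j → fromℤ i ℚ.< fromℤ j
fromℤ-mono-< {i} {j} i<j rewrite fromℤ≡mkℚ₁ i | fromℤ≡mkℚ₁ j =
  ℚ.*<* (subst₂ ℤ._<_ (sym (ℤP.*-identityʳ i)) (sym (ℤP.*-identityʳ j)) i<j)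

level : Point → ℤ
level p = + 2 ℤ.* xc p ℤ.+ yc p

wedgeCoordinate-level : ∀ v q →
  two ℚ.* (fromℤ (xc q) ℚ.- fromℤ (xc v)) ℚ.+ (fromℤ (yc q) ℚ.- fromℤ (yc v))
    ≡ fromℤ (level q ℤ.- level v)
wedgeCoordinate-level (xv , yv) (xq , yq) = begin
  two ℚ.* (fromℤ xq ℚ.- fromℤ xv) ℚ.+ (fromℤ yq ℚ.- fromℤ yv)
    ≡⟨ sym (cong₂ (λ a b → two ℚ.* a ℚ.+ b) (fromℤ-homo-- xq xv) (fromℤ-homo-- yq yv)) ⟩
  fromℤ (+ 2) ℚ.* fromℤ (xq ℤ.- xv) ℚ.+ fromℤ (yq ℤ.- yv)
    ≡⟨ cong (ℚ._+ fromℤ (yq ℤ.- yv)) (sym (fromℤ-homo-* (+ 2) (xq ℤ.- xv))) ⟩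
  fromℤ (+ 2 ℤ.* (xq ℤ.- xv)) ℚ.+ fromℤ (yq ℤ.- yv)
    ≡⟨ sym (fromℤ-homo-+ (+ 2 ℤ.* (xq ℤ.- xv)) (yq ℤ.- yv)) ⟩
  fromℤ (+ 2 ℤ.* (xq ℤ.- xv) ℤ.+ (yq ℤ.- yv))
    ≡⟨ cong fromℤ (regroup xq xv yq yv) ⟩
  fromℤ ((+ 2 ℤ.* xq ℤ.+ yq) ℤ.- (+ 2 ℤ.* xv ℤ.+ yv))
    ∎
  where
  regroup : ∀ a b c d →
    + 2 ℤ.* (a ℤ.- b) ℤ.+ (c ℤ.- d) ≡ (+ 2 ℤ.* a ℤ.+ c) ℤ.- (+ 2 ℤ.* b ℤ.+ d)
  regroup = solve-∀

InS-toQ : ∀ {v q} → yc q ℤ.≤ yc v → level v ℤ.≤ level q → InS v (toQ q)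
InS-toQ {v} {q} below above =
    subst (ℚ._≤ 0ℚ) (fromℤ-homo-- (yc q) (yc v)) (fromℤ-mono-≤ (ℤP.i≤j⇒i-j≤0 below))
  , subst (0ℚ ℚ.≤_) (sym (wedgeCoordinate-level v q)) (fromℤ-mono-≤ (ℤP.i≤j⇒0≤j-i above))

InL-toQ⇒level≡ : ∀ {v q} → InL v (toQ q) → level q ≡ level v
InL-toQ⇒level≡ {v} {q} (_ , onLine) = ℤP.i-j≡0⇒i≡j (level q) (level v) (fromℤ-injective (begin
  fromℤ (level q ℤ.- level v)  ≡⟨ sym (wedgeCoordinate-level v q) ⟩
  two ℚ.* dx ℚ.+ dy            ≡⟨ cong (two ℚ.* dx ℚ.+_) onLine ⟩
  two ℚ.* dx ℚ.- two ℚ.* dx    ≡⟨ ℚP.+-inverseʳ (two ℚ.* dx) ⟩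
  0ℚ                           ∎))
  where
  dx dy : ℚ
  dx = fromℤ (xc q) ℚ.- fromℤ (xc v)
  dy = fromℤ (yc q) ℚ.- fromℤ (yc v)

OnSeg-start : ∀ a b → OnSeg a b a
OnSeg-start (ax , ay) (bx , by) =
  0ℚ , ℚP.≤-refl , ℚ.*≤* (ℤ.+≤+ ℕ.z≤n) , sym (+0*≡ ax (bx ℚ.- ax)) , sym (+0*≡ ay (by ℚ.- ay))
  where
  +0*≡ : ∀ a d → a ℚ.+ 0ℚ ℚ.* d ≡ a
  +0*≡ a d = trans (cong (a ℚ.+_) (ℚP.*-zeroˡ d)) (ℚP.+-identityʳ a)

OnSeg-horizontal : ∀ {a b rx ry} → a ℚ.≤ b → OnSeg (a , 0ℚ) (b , 0ℚ) (rx , ry) →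
  ry ≡ 0ℚ × a ℚ.≤ rx
OnSeg-horizontal {a} {b} {rx} {ry} a≤b (t , 0≤t , _ , rx≡ , ry≡) = ry≡0 , a≤rx
  where
  ry≡0 : ry ≡ 0ℚ
  ry≡0 = begin
    _                          ≡⟨ ry≡ ⟩
    0ℚ ℚ.+ t ℚ.* (0ℚ ℚ.- 0ℚ)   ≡⟨ cong (λ d → 0ℚ ℚ.+ t ℚ.* d) (ℚP.+-inverseʳ 0ℚ) ⟩
    0ℚ ℚ.+ t ℚ.* 0ℚ            ≡⟨ cong (0ℚ ℚ.+_) (ℚP.*-zeroʳ t) ⟩
    0ℚ                         ∎
  0≤b-a : 0ℚ ℚ.≤ b ℚ.- a
  0≤b-a = subst (ℚ._≤ b ℚ.- a) (ℚP.+-inverseʳ a) (ℚP.+-monoˡ-≤ (ℚ.- a) a≤b)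
  0≤t[b-a] : 0ℚ ℚ.≤ t ℚ.* (b ℚ.- a)
  0≤t[b-a] = subst (ℚ._≤ t ℚ.* (b ℚ.- a)) (ℚP.*-zeroˡ (b ℚ.- a))
    (ℚP.*-monoʳ-≤-nonNeg (b ℚ.- a) {{ℚ.nonNegative 0≤b-a}} 0≤t)
  a≤rx : a ℚ.≤ rx
  a≤rx = subst₂ ℚ._≤_ (ℚP.+-identityʳ a) (sym rx≡) (ℚP.+-monoʳ-≤ a 0≤t[b-a])

InIntS-onAxis : ∀ {v a rx} → 0ℤ ℤ.< yc v → level v ℤ.< + 2 ℤ.* a → fromℤ a ℚ.≤ rx →
  InIntS v (rx , 0ℚ)
InIntS-onAxis {v} {a} {rx} 0<y level<2a a≤rx = below , inside
  where
  below : 0ℚ ℚ.- fromℤ (yc v) ℚ.< 0ℚ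
  below = subst (ℚ._< 0ℚ) (fromℤ-homo-- 0ℤ (yc v)) (fromℤ-mono-<
    (subst (ℤ._< 0ℤ) (sym (ℤP.+-identityˡ (ℤ.- yc v))) (ℤP.neg-mono-< 0<y)))
  0<2a-level : 0ℤ ℤ.< level (a , 0ℤ) ℤ.- level v
  0<2a-level = subst₂ ℤ._<_ (ℤP.+-inverseʳ (level v)) refl (ℤP.+-monoˡ-< (ℤ.- level v)
    (subst (level v ℤ.<_) (sym (ℤP.+-identityʳ _)) level<2a))
  inside : 0ℚ ℚ.< two ℚ.* (rx ℚ.- fromℤ (xc v)) ℚ.+ (0ℚ ℚ.- fromℤ (yc v))
  inside = ℚP.<-≤-trans
    (subst (0ℚ ℚ.<_) (sym (wedgeCoordinate-level v (a , 0ℤ))) (fromℤ-mono-< 0<2a-level))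
    (ℚP.+-monoˡ-≤ (0ℚ ℚ.- fromℤ (yc v))
      (ℚP.*-monoˡ-≤-nonNeg two (ℚP.+-monoˡ-≤ (ℚ.- fromℤ (xc v)) a≤rx)))

mutual
  edges-parent∈verts : ∀ t {e} → e ∈ edges t → proj₂ e ∈ verts t
  edges-parent∈verts (node q ts) e∈ with ∈-++⁻ (map (λ t → root t , q) ts) e∈
  ... | inj₂ e∈F = there (edgesF-parent∈vertsF ts e∈F)
  ... | inj₁ e∈map with ∈-map⁻ (λ t → root t , q) e∈map
  ...   | _ , _ , refl = here refl

  edgesF-parent∈vertsF : ∀ F {e} → e ∈ edgesF F → proj₂ e ∈ vertsF F
  edgesF-parent∈vertsF (t ∷ F) e∈ with ∈-++⁻ (edges t) e∈
  ... | inj₁ e∈t = ∈-++⁺ˡ (edges-parent∈verts t e∈t)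
  ... | inj₂ e∈F = ∈-++⁺ʳ (verts t) (edgesF-parent∈vertsF F e∈F)

module _ (B : Point → Set) where

  InheritedAlong : List (Point × Point) → Set
  InheritedAlong es = ∀ {e} → e ∈ es → B (proj₂ e) → B (proj₁ e)

  mutual
    All-verts⁺ : ∀ t → B (root t) → InheritedAlong (edges t) → All B (verts t)
    All-verts⁺ (node q ts) Bq inherit =
      Bq ∷ All-vertsF⁺ ts
        (All.tabulate λ t∈ → inherit (∈-++⁺ˡ (∈-map⁺ (λ t → root t , q) t∈)) Bq)
        (λ e∈ → inherit (∈-++⁺ʳ _ e∈))

    All-vertsF⁺ : ∀ F → All (λ t → B (root t)) F → InheritedAlong (edgesF F) →
      All B (vertsF F)
    All-vertsF⁺ []      []        _       = []
    All-vertsF⁺ (t ∷ F) (Bt ∷ BF) inherit = AllP.++⁺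
      (All-verts⁺ t Bt (λ e∈ → inherit (∈-++⁺ˡ e∈)))
      (All-vertsF⁺ F BF (λ e∈ → inherit (∈-++⁺ʳ (edges t) e∈)))

MeetsWedgesOnlyAlongℓ : DForest → Set
MeetsWedgesOnlyAlongℓ F = ∀ v r → v ∈ vertsF F → OnDrawing F r → InS v r → InL v r

level-child≤parent : ∀ {F e} → StrictlyUpward F → MeetsWedgesOnlyAlongℓ F →
  e ∈ edgesF F → level (proj₁ e) ℤ.≤ level (proj₂ e)
level-child≤parent {F} {e@(c , p)} upward onlyAlongℓ e∈
  with ℤP.≤-total (level c) (level p)
... | inj₁ c≤p = c≤p
... | inj₂ p≤c = ℤP.≤-reflexive (InL-toQ⇒level≡ {p} {c} (onlyAlongℓ p (toQ c)
  (edgesF-parent∈vertsF F e∈)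
  (inj₂ (e , e∈ , OnSeg-start (toQ c) (toQ p)))
  (InS-toQ {p} {c} (ℤP.<⇒≤ (All.lookup upward e∈)) p≤c)))

level≤-onYAxis : ∀ {p top} → xc p ≡ 0ℤ → yc p ℤ.≤ top → level p ℤ.≤ top
level≤-onYAxis {p} x≡0 y≤top =
  subst (ℤ._≤ _) (sym (trans (cong (λ x → + 2 ℤ.* x ℤ.+ yc p) x≡0) (ℤP.+-identityˡ (yc p)))) y≤top

cornerBox-bottom-positive : ∀ {m W} → m ≤ W → 0ℤ ℤ.< + 4 ℤ.* + W ℤ.- + 2 ℤ.* + m ℤ.+ + 2
cornerBox-bottom-positive {m} {W} m≤W = subst (0ℤ ℤ.<_) (sym (regroup (+ W) (+ m)))
  (ℤP.+-mono-≤-< (ℤP.*-monoˡ-≤-nonNeg (+ 2)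
    (ℤP.+-mono-≤ (ℤP.i≤j⇒0≤j-i (ℤ.+≤+ m≤W)) (ℤ.+≤+ ℕ.z≤n))) (ℤ.+<+ (ℕ.s≤s ℕ.z≤n)))
  where
  regroup : ∀ w n → + 4 ℤ.* w ℤ.- + 2 ℤ.* n ℤ.+ + 2 ≡ + 2 ℤ.* ((w ℤ.- n) ℤ.+ w) ℤ.+ + 2
  regroup = solve-∀

2W+2≤4W : ∀ {W} → 1 ≤ W → 2 * W + 2 ≤ 4 * W
2W+2≤4W {W} 1≤W =
  subst (2 * W + 2 ≤_) (sym (ℕP.*-distribʳ-+ W 2 2)) (ℕP.+-monoʳ-≤ (2 * W) (ℕP.*-monoʳ-≤ 2 1≤W))

4W<2[2W+2] : ∀ W → + 4 ℤ.* + W ℤ.< + 2 ℤ.* + (2 * W + 2)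
4W<2[2W+2] W = subst₂ ℤ._<_ (ℤP.pos-* 4 W) (ℤP.pos-* 2 (2 * W + 2))
  (ℤ.+<+ (subst (4 * W ℕ.<_) (regroup W) (ℕP.m<m+n (4 * W) (ℕ.s≤s ℕ.z≤n))))
  where
  regroup : ∀ W → 4 * W + 4 ≡ 2 * (2 * W + 2)
  regroup = ℕ-solve-∀

mainTheorem6 : (W : ℕ) → 1 ≤ W → (F : DForest) → nVerts F ≤ W →
    IsCornerDrawing W F →
    ∀ v r → v ∈ vertsF F →
    OnSeg ((+ (2 * W + 2) / 1) , 0ℚ) ((+ (4 * W) / 1) , 0ℚ) r →
    InIntS v r
mainTheorem6 W 1≤W F m≤W (_ , upward , _ , _ , box , roots , _ , _ , _ , _ , onlyAlongℓ)
  v (rx , ry) v∈ onSegment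
  with OnSeg-horizontal (fromℤ-mono-≤ (ℤ.+≤+ (2W+2≤4W 1≤W))) onSegment
... | refl , 2W+2≤rx = InIntS-onAxis {v} {+ (2 * W + 2)} 0<yv level<2[2W+2] 2W+2≤rx
  where
  levels≤4W : All (λ p → level p ℤ.≤ + 4 ℤ.* + W) (vertsF F)
  levels≤4W = All-vertsF⁺ _ F
    (All.map (λ (x≡0 , _ , y≤4W) → level≤-onYAxis x≡0 y≤4W) (AllP.map⁻ roots))
    (λ e∈ → ℤP.≤-trans (level-child≤parent {F} upward onlyAlongℓ e∈))
  0<yv : 0ℤ ℤ.< yc v
  0<yv = ℤP.<-≤-trans (cornerBox-bottom-positive m≤W) (proj₁ (proj₂ (proj₂ (All.lookup box v∈))))
  level<2[2W+2] : level v ℤ.< + 2 ℤ.* + (2 * W + 2)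
  level<2[2W+2] = ℤP.≤-<-trans (All.lookup levels≤4W v∈) (4W<2[2W+2] W)
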